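{- Let $k\ge 1$ and $i$ be integers with $i\ge k$. Then $$f(2^{k-1}+1,i) = (k-1)+(i-k)k.$$
   Context: For an integer $n$ and an integer $i\ge 0$, $f(n,i)$ denotes the number of binary signed-digit (BSD) representations of $n$ on $i$ bits, i.e. the number of tuples $(b_{i-1},\dots,b_0)\in\{1,0,-1\}^i$ with $n=\sum_{j=0}^{i-1} b_j 2^j$. -}

module Defs where

open import Data.Nat using (ℕ; zero; suc)
open import Data.Integer using (ℤ; +_; -[1+_]; _+_; _*_)
open import Data.Integer.Properties using (_≟_)
open import Data.List using (List; []; _∷_; concatMap; map; length; filter)
open import Data.Vec using (Vec; []; _∷_)
open import Relation.Unary using (Decidable)

digits : List ℤ
digits = + 1 ∷ + 0 ∷ -[1+ 0 ] ∷ []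

-- All tuples in {1,0,-1}^i, as vectors b = (b_0 , b_1 , … , b_{i-1})
-- (least significant digit first).
allBSD : (i : ℕ) → List (Vec ℤ i)
allBSD zero    = [] ∷ []
allBSD (suc i) = concatMap (λ d → map (d ∷_) (allBSD i)) digits

value : {i : ℕ} → Vec ℤ i → ℤ
value []       = + 0
value (b ∷ bs) = b + + 2 * value bs

f : ℤ → ℕ → ℕ
f n i = length (filter (λ b → value b ≟ n) (allBSD i))

{-# OPTIONS --safe #-}
-- Splitting off the lowest digit b₀ of a representation of n on i + 1 bits
-- leaves a representation of (n − b₀)/2 on i bits, and (n − b₀)/2 is an
-- integer for exactly one b₀ when n is even and for b₀ = ±1 when n is odd.
-- Hence f(2m, i+1) = f(m, i) and f(2m+1, i+1) = f(m, i) + f(m+1, i).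
-- Halving 2^m down to 1 gives f(2^m, m + j) = f(1, j) = j, and unfolding
-- f(2^m + 1, m + 1 + j) = f(2^(m-1), m + j) + f(2^(m-1) + 1, m + j)
-- adds j + 1 per step, starting from f(2, 1 + j) = f(1, j) = j.
module Submission where

open import Defs
open import Data.Nat using (ℕ; suc; _+_; _*_; _∸_; _^_; _≤_)
open import Data.Integer using (+_)
open import Relation.Binary.PropositionalEquality using (_≡_)

open import Data.Nat using (s≤s; z≤n)
import Data.Nat.Properties as ℕ
open import Data.Nat.ListAction using (sum)
import Data.Nat.Tactic.RingSolver as ℕ-Solver
open import Data.Integer using (ℤ; -[1+_]; ∣_∣) renaming (_+_ to _+ℤ_; _*_ to _*ℤ_; _-_ to _-ℤ_)
import Data.Integer.Properties as ℤ
open import Data.Integer.Tactic.RingSolver using (solve-∀)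
open import Algebra.Bundles using (AbelianGroup)
open import Algebra.Properties.Group (AbelianGroup.group ℤ.+-0-abelianGroup) using (∙-cancelˡ)
open import Data.List using (List; []; _∷_; _++_; map; concatMap; filter; length)
open import Data.List.Properties using (filter-++; filter-≐; length-++)
open import Data.Vec using (Vec; _∷_)
open import Data.Product using (_,_)
open import Data.Empty using (⊥-elim)
open import Relation.Nullary using (¬_; yes; no)
open import Level using (0ℓ)
open import Relation.Unary using (Pred; Decidable; _≐_)
open import Relation.Binary.PropositionalEquality
  using (_≢_; refl; sym; trans; cong; cong₂; module ≡-Reasoning)
open ≡-Reasoning

module _ {A : Set} {P : Pred A 0ℓ} (P? : Decidable P) where

  length-filter-++ : ∀ xs ys →
    length (filter P? (xs ++ ys)) ≡ length (filter P? xs) + length (filter P? ys)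
  length-filter-++ xs ys = trans (cong length (filter-++ P? xs ys)) (length-++ (filter P? xs))

  length-filter-concatMap : {B : Set} (g : B → List A) (ys : List B) →
    length (filter P? (concatMap g ys)) ≡ sum (map (λ y → length (filter P? (g y))) ys)
  length-filter-concatMap g []       = refl
  length-filter-concatMap g (y ∷ ys) =
    trans (length-filter-++ (g y) (concatMap g ys))
          (cong (λ n → length (filter P? (g y)) + n) (length-filter-concatMap g ys))

  length-filter-map : {B : Set} (g : B → A) (xs : List B) →
    length (filter P? (map g xs)) ≡ length (filter (λ x → P? (g x)) xs)
  length-filter-map g []       = refl
  length-filter-map g (x ∷ xs) with P? (g x)
  ... | yes _ = cong suc (length-filter-map g xs)
  ... | no  _ = length-filter-map g xs

  length-filter-none : (∀ x → ¬ P x) → ∀ xs → length (filter P? xs) ≡ 0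
  length-filter-none ¬P []       = refl
  length-filter-none ¬P (x ∷ xs) with P? x
  ... | yes p = ⊥-elim (¬P x p)
  ... | no  _ = length-filter-none ¬P xs

length-filter-≐ : {A : Set} {P Q : Pred A 0ℓ} (P? : Decidable P) (Q? : Decidable Q) →
  P ≐ Q → ∀ xs → length (filter P? xs) ≡ length (filter Q? xs)
length-filter-≐ P? Q? P≐Q xs = cong length (filter-≐ P? Q? P≐Q xs)

2*≢1+2* : ∀ x y → + 2 *ℤ x ≢ + 1 +ℤ + 2 *ℤ y
2*≢1+2* x y eq = 2≢1 (ℕ.m*n≡1⇒m≡1 2 ∣ x -ℤ y ∣ (begin
  2 * ∣ x -ℤ y ∣                   ≡⟨ ℤ.abs-* (+ 2) (x -ℤ y) ⟨
  ∣ + 2 *ℤ (x -ℤ y) ∣              ≡⟨ cong ∣_∣ (begin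
    + 2 *ℤ (x -ℤ y)                  ≡⟨ difference-of-doubles x y ⟩
    + 2 *ℤ x -ℤ + 2 *ℤ y             ≡⟨ cong (_-ℤ + 2 *ℤ y) eq ⟩
    (+ 1 +ℤ + 2 *ℤ y) -ℤ + 2 *ℤ y    ≡⟨ odd-minus-even y ⟩
    + 1                              ∎) ⟩
  1                                ∎))
  where
  2≢1 : ¬ (2 ≡ 1)
  2≢1 ()
  difference-of-doubles : ∀ x y → + 2 *ℤ (x -ℤ y) ≡ + 2 *ℤ x -ℤ + 2 *ℤ y
  difference-of-doubles = solve-∀
  odd-minus-even : ∀ y → (+ 1 +ℤ + 2 *ℤ y) -ℤ + 2 *ℤ y ≡ + 1
  odd-minus-even = solve-∀

countWithLowDigit : ℤ → ℤ → ℕ → ℕ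
countWithLowDigit d n i = length (filter (λ b → value b ℤ.≟ n) (map (d ∷_) (allBSD i)))

f-suc : ∀ n i → f n (suc i) ≡ sum (map (λ d → countWithLowDigit d n i) digits)
f-suc n i = length-filter-concatMap (λ b → value b ℤ.≟ n) (λ d → map (d ∷_) (allBSD i)) digits

countWithLowDigit-even : ∀ {d n} m i → d +ℤ + 2 *ℤ m ≡ n → countWithLowDigit d n i ≡ f m i
countWithLowDigit-even {d} {n} m i d+2m≡n =
  trans (length-filter-map (λ b → value b ℤ.≟ n) (d ∷_) (allBSD i))
        (length-filter-≐ (λ b → d +ℤ + 2 *ℤ value b ℤ.≟ n) (λ b → value b ℤ.≟ m)
                         ((λ {b} → to {b}) , (λ {b} → from {b})) (allBSD i))
  where
  to : ∀ {b : Vec ℤ i} → d +ℤ + 2 *ℤ value b ≡ n → value b ≡ m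
  to eq = ℤ.*-cancelˡ-≡ (+ 2) _ m (∙-cancelˡ d _ _ (trans eq (sym d+2m≡n)))
  from : ∀ {b : Vec ℤ i} → value b ≡ m → d +ℤ + 2 *ℤ value b ≡ n
  from eq = trans (cong (λ v → d +ℤ + 2 *ℤ v) eq) d+2m≡n

countWithLowDigit-odd : ∀ {d n} m i → d +ℤ (+ 1 +ℤ + 2 *ℤ m) ≡ n → countWithLowDigit d n i ≡ 0
countWithLowDigit-odd {d} {n} m i d+2m+1≡n =
  trans (length-filter-map (λ b → value b ℤ.≟ n) (d ∷_) (allBSD i))
        (length-filter-none _ parity-mismatch (allBSD i))
  where
  parity-mismatch : ∀ b → ¬ (d +ℤ + 2 *ℤ value b ≡ n)
  parity-mismatch b eq = 2*≢1+2* (value b) m (∙-cancelˡ d _ _ (trans eq (sym d+2m+1≡n)))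

f-suc-even : ∀ m i → f (+ 2 *ℤ m) (suc i) ≡ f m i
f-suc-even m i = begin
  f (+ 2 *ℤ m) (suc i)                       ≡⟨ f-suc (+ 2 *ℤ m) i ⟩
  c (+ 1) + (c (+ 0) + (c -[1+ 0 ] + 0))     ≡⟨ cong₂ _+_
                                                  (countWithLowDigit-odd (m -ℤ + 1) i (low-one m))
                                                  (cong₂ _+_ (countWithLowDigit-even m i (ℤ.+-identityˡ _))
                                                             (cong (_+ 0) (countWithLowDigit-odd m i (low-minus-one m)))) ⟩
  f m i + 0                                  ≡⟨ ℕ.+-identityʳ (f m i) ⟩
  f m i                                      ∎
  where
  c : ℤ → ℕ
  c d = countWithLowDigit d (+ 2 *ℤ m) i
  low-one : ∀ m → + 1 +ℤ (+ 1 +ℤ + 2 *ℤ (m -ℤ + 1)) ≡ + 2 *ℤ m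
  low-one = solve-∀
  low-minus-one : ∀ m → -[1+ 0 ] +ℤ (+ 1 +ℤ + 2 *ℤ m) ≡ + 2 *ℤ m
  low-minus-one = solve-∀

f-suc-odd : ∀ m i → f (+ 1 +ℤ + 2 *ℤ m) (suc i) ≡ f m i + f (m +ℤ + 1) i
f-suc-odd m i = begin
  f n (suc i)                                ≡⟨ f-suc n i ⟩
  c (+ 1) + (c (+ 0) + (c -[1+ 0 ] + 0))     ≡⟨ cong₂ _+_
                                                  (countWithLowDigit-even m i refl)
                                                  (cong₂ _+_ (countWithLowDigit-odd m i (ℤ.+-identityˡ _))
                                                             (cong (_+ 0) (countWithLowDigit-even (m +ℤ + 1) i (low-minus-one m)))) ⟩
  f m i + (0 + (f (m +ℤ + 1) i + 0))         ≡⟨ cong (λ k → f m i + k) (ℕ.+-identityʳ _) ⟩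
  f m i + f (m +ℤ + 1) i                     ∎
  where
  n : ℤ
  n = + 1 +ℤ + 2 *ℤ m
  c : ℤ → ℕ
  c d = countWithLowDigit d n i
  low-minus-one : ∀ m → -[1+ 0 ] +ℤ + 2 *ℤ (m +ℤ + 1) ≡ + 1 +ℤ + 2 *ℤ m
  low-minus-one = solve-∀

f-zero : ∀ i → f (+ 0) i ≡ 1
f-zero 0       = refl
f-zero (suc i) = trans (f-suc-even (+ 0) i) (f-zero i)

f-one : ∀ i → f (+ 1) i ≡ i
f-one 0       = refl
f-one (suc i) = trans (f-suc-odd (+ 0) i) (cong₂ _+_ (f-zero i) (f-one i))

f-2^ : ∀ m j → f (+ (2 ^ m)) (m + j) ≡ j
f-2^ 0       j = f-one j
f-2^ (suc m) j = begin
  f (+ (2 * 2 ^ m)) (suc (m + j))    ≡⟨ cong (λ n → f n (suc (m + j))) (ℤ.pos-* 2 (2 ^ m)) ⟩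
  f (+ 2 *ℤ + 2 ^ m) (suc (m + j))   ≡⟨ f-suc-even (+ 2 ^ m) (m + j) ⟩
  f (+ (2 ^ m)) (m + j)              ≡⟨ f-2^ m j ⟩
  j                                  ∎

f-2^+1 : ∀ m j → f (+ (2 ^ m + 1)) (suc m + j) ≡ m + j * suc m
f-2^+1 0       j = trans (f-suc-even (+ 1) j) (trans (f-one j) (sym (ℕ.*-identityʳ j)))
f-2^+1 (suc m) j = begin
  f (+ (2 * 2 ^ m + 1)) (suc (suc m + j))                   ≡⟨ cong (λ n → f n (suc (suc m + j))) (odd-pos (2 ^ m)) ⟩
  f (+ 1 +ℤ + 2 *ℤ + 2 ^ m) (suc (suc m + j))               ≡⟨ f-suc-odd (+ 2 ^ m) (suc m + j) ⟩
  f (+ 2 ^ m) (suc m + j) + f (+ 2 ^ m +ℤ + 1) (suc m + j)  ≡⟨ cong₂ _+_ even-half odd-half ⟩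
  suc j + (m + j * suc m)                                   ≡⟨ ring m j ⟩
  suc m + j * suc (suc m)                                   ∎
  where
  odd-pos : ∀ k → + (2 * k + 1) ≡ + 1 +ℤ + 2 *ℤ + k
  odd-pos k = trans (cong +_ (ℕ.+-comm (2 * k) 1)) (cong (+ 1 +ℤ_) (ℤ.pos-* 2 k))
  even-half : f (+ 2 ^ m) (suc m + j) ≡ suc j
  even-half = trans (cong (f (+ 2 ^ m)) (sym (ℕ.+-suc m j))) (f-2^ m (suc j))
  odd-half : f (+ 2 ^ m +ℤ + 1) (suc m + j) ≡ m + j * suc m
  odd-half = trans (cong (λ n → f n (suc m + j)) (sym (ℤ.pos-+ (2 ^ m) 1))) (f-2^+1 m j)
  ring : ∀ m j → suc j + (m + j * suc m) ≡ suc m + j * suc (suc m)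
  ring = ℕ-Solver.solve-∀

lemma3 : (k i : ℕ) → 1 ≤ k → k ≤ i →
    f (+ (2 ^ (k ∸ 1) + 1)) i ≡ (k ∸ 1) + (i ∸ k) * k
lemma3 (suc m) i (s≤s z≤n) k≤i with ℕ.m≤n⇒∃[o]m+o≡n k≤i
... | j , refl = begin
  f (+ (2 ^ m + 1)) (suc m + j)    ≡⟨ f-2^+1 m j ⟩
  m + j * suc m                    ≡⟨ cong (λ t → m + t * suc m) (ℕ.m+n∸m≡n (suc m) j) ⟨
  m + (suc m + j ∸ suc m) * suc m  ∎
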